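{- For all integers $k \ge 1$ and $v \ge 1$, every interval graph $G$ with $\vartheta(G) \le (v+1)^k - 1$ satisfies $\kappa(G,v) \le k$.
   Context: All graphs are finite and simple. An interval graph is the intersection graph of a finite family of open intervals of the real line. The claw number of a graph $G$ is the largest integer $v \ge 0$ such that the star $K_{1,v}$ is an induced subgraph of $G$. The vertex-clique-partition number $\vartheta(G)$ is the minimum number of parts in a partition of $V(G)$ into cliques. For $v \ge 1$, $\kappa(G,v)$ is the smallest number of parts in a partition of $V(G)$ into subsets each inducing a subgraph with claw number at most $v$.
   Formalization: The open intervals representing G have rational endpoints instead of arbitrary points of the real line. -}

module Defs where

open import Data.Nat using (ℕ; suc)
open import Data.Fin using (Fin)
open import Data.Product using (Σ; _×_; ∃)
open import Data.Rational using (ℚ; _<_)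
open import Relation.Nullary using (¬_)
open import Relation.Binary.PropositionalEquality using (_≡_; _≢_)
open import Function.Bundles using (_⇔_)
open import Function.Definitions using (Injective)
open import Level using (0ℓ)

record Graph (n : ℕ) : Set₁ where
  field
    Adj     : Fin n → Fin n → Set
    sym     : ∀ {i j} → Adj i j → Adj j i
    irrefl  : ∀ {i} → ¬ Adj i i
open Graph public

-- G is an interval graph: intersection graph of the open intervals (l i , r i), l i < r i.
-- Endpoints are taken rational.
-- Distinct open intervals (a,b),(c,d) intersect iff a < d and c < b.
IsIntervalGraph : ∀ {n} → Graph n → Set
IsIntervalGraph {n} G =
  Σ (Fin n → ℚ) λ l → Σ (Fin n → ℚ) λ r →
    (∀ i → l i < r i) ×
    (∀ i j → i ≢ j → (Adj G i j ⇔ (l i < r j × l j < r i)))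

CliquePartition : ∀ {n} → Graph n → ℕ → Set
CliquePartition {n} G m =
  Σ (Fin n → Fin m) λ f → ∀ i j → f i ≡ f j → i ≢ j → Adj G i j

ϑ≤ : ∀ {n} → Graph n → ℕ → Set
ϑ≤ G m = CliquePartition G m

HasInducedStar : ∀ {n} → Graph n → (Fin n → Set) → ℕ → Set
HasInducedStar {n} G S w =
  Σ (Fin n) λ c → Σ (Fin w → Fin n) λ x →
    S c × (∀ a → S (x a)) × Injective _≡_ _≡_ x ×
    (∀ a → Adj G c (x a)) ×
    (∀ a b → ¬ Adj G (x a) (x b))

ClawNumber≤ : ∀ {n} → Graph n → (Fin n → Set) → ℕ → Set
ClawNumber≤ G S v = ¬ HasInducedStar G S (suc v)

κ≤ : ∀ {n} → Graph n → ℕ → ℕ → Set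
κ≤ {n} G v k =
  Σ (Fin n → Fin k) λ g → ∀ (p : Fin k) → ClawNumber≤ G (λ i → g i ≡ p) v

{-# OPTIONS --safe #-}
module Submission where

-- Each clique of intervals has a common point, its largest left endpoint, so fewer than
-- (v+1)^k points, numbered 1, 2, … from left to right, stab all the intervals.  Colour an
-- interval by the largest t < k such that it contains a point whose number is a multiple
-- of (v+1)^t.  In an induced star of colour t, pick for each leaf such a point.  No vertex
-- of the star contains a point numbered by a multiple of (v+1)^(t+1), yet the centre meets
-- two leaves and so contains every point between them that neither leaf contains.  Hence
-- the picked points lie strictly between two consecutive multiples of (v+1)^(t+1), where
-- there are only v multiples of (v+1)^t, and two of the v+1 leaves share a point,
-- contradicting their non-adjacency.

open import Defs hiding (sym)
open import Data.Nat using (ℕ; zero; suc; _∸_; _^_; _≥_; _≤_; _<_; _*_; _+_; s≤s; NonZero)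
open import Data.Nat.Properties
  using (≤-refl; ≤-reflexive; <⇒≢; ≤-trans; ≤-<-trans; ≤-antisym; <⇒≤; <⇒≱; ≮⇒≥; ≰⇒>; m≤n⇒m≤1+n;
         *-assoc; *-monoˡ-≤; suc-injective; suc-pred; m^n≢0)
open import Data.Nat.Divisibility using (_∣_; divides; _∣?_; ∣⇒≤; 1∣_; *-monoˡ-∣; m%n≡0⇒n∣m)
open import Data.Nat.DivMod using (_/_; _%_; _mod_; m≡m%n+[m/n]*n; m/n*n≤m; m*n/n≡m; /-monoˡ-≤)
open import Data.Fin as Fin using (Fin; zero; toℕ; fromℕ<; punchOut)
open import Data.Fin.Properties
  using (toℕ-fromℕ<; toℕ-injective; toℕ<n; any?; pigeonhole; punchOut-injective)
  renaming (_≟_ to _≟ᶠ_)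
open import Data.Rational as ℚ using (ℚ; 0ℚ)
open import Data.Rational.Properties as ℚ using (≤-decTotalOrder)
open import Data.Product using (∃; _×_; _,_; proj₁; proj₂)
open import Data.Sum using ([_,_]′)
open import Relation.Binary.Bundles using (DecTotalOrder)
open import Data.List using (List; []; _∷_; filter; tabulate; length; lookup; allFin)
open import Data.List.Properties using (length-tabulate)
open import Data.List.Relation.Unary.All as All using (All; []; _∷_)
open import Data.List.Relation.Unary.Any using (here; there; index)
open import Data.List.Relation.Unary.Any.Properties using (lookup-index)
open import Data.List.Membership.Propositional using (_∈_)
open import Data.List.Membership.Propositional.Properties
  using (∈-allFin; ∈-tabulate⁺; ∈-filter⁺; ∈-filter⁻)
open import Data.List.Relation.Binary.Permutation.Propositional using (↭-sym)
open import Data.List.Relation.Binary.Permutation.Propositional.Properties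
  using (∈-resp-↭; ↭-length)
open import Data.List.Sort ≤-decTotalOrder using (sort; sort-↭; sort-↗)
open import Data.List.Relation.Unary.Sorted.TotalOrder.Properties using (lookup-mono-≤)
open import Data.List.Extrema (DecTotalOrder.totalOrder ≤-decTotalOrder)
  using (argmax; argmax-sel; f[⊥]≤f[argmax]; f[xs]≤f[argmax])
open import Relation.Binary.PropositionalEquality
  using (_≡_; _≢_; refl; sym; trans; cong; cong₂; subst; module ≡-Reasoning)
open import Data.Empty using (⊥)
open import Relation.Nullary using (Dec; yes; no; ¬_)
open import Relation.Nullary.Decidable using (_×-dec_)
open import Relation.Unary using (Decidable)
open import Function using (_∘_)
open import Function.Bundles using (Equivalence; _⇔_)
open import Function.Definitions using (Injective)

module _ {P : ℕ → Set} (P? : Decidable P) where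

  greatest : ℕ → ℕ
  greatest zero = zero
  greatest (suc t) with P? (suc t)
  ... | yes _ = suc t
  ... | no _ = greatest t

  greatest-≤ : ∀ t → greatest t ≤ t
  greatest-≤ zero = ≤-refl
  greatest-≤ (suc t) with P? (suc t)
  ... | yes _ = ≤-refl
  ... | no _ = m≤n⇒m≤1+n (greatest-≤ t)

  greatest-satisfies : P 0 → ∀ t → P (greatest t)
  greatest-satisfies P0 zero = P0
  greatest-satisfies P0 (suc t) with P? (suc t)
  ... | yes Pt = Pt
  ... | no _ = greatest-satisfies P0 t

  greatest-maximal : ∀ t → ¬ P (suc t) → ¬ P (suc (greatest t))
  greatest-maximal zero ¬P1 = ¬P1
  greatest-maximal (suc t) ¬P with P? (suc t)
  ... | yes _ = ¬P
  ... | no ¬Pt = greatest-maximal t ¬Pt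

m/n<o/n⇒m<o/n*n : ∀ n .{{_ : NonZero n}} {m o} → m / n < o / n → m < o / n * n
m/n<o/n⇒m<o/n*n n {m} {o} lt = ≰⇒> λ o/n*n≤m →
  <⇒≱ lt (≤-trans (≤-reflexive (sym (m*n/n≡m (o / n) n))) (/-monoˡ-≤ n o/n*n≤m))

/-%-injective : ∀ n .{{_ : NonZero n}} {m o} → m / n ≡ o / n → m % n ≡ o % n → m ≡ o
/-%-injective n {m} {o} /≡ %≡ = begin
  m                  ≡⟨ m≡m%n+[m/n]*n m n ⟩
  m % n + m / n * n  ≡⟨ cong₂ (λ a b → a + b * n) %≡ /≡ ⟩
  o % n + o / n * n  ≡⟨ sym (m≡m%n+[m/n]*n o n) ⟩
  o                  ∎
  where open ≡-Reasoning

module Intervals {I : Set} (l r : I → ℚ) where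

  -- half-open, since the common point of a clique is one of its left endpoints
  _∋_ : I → ℚ → Set
  i ∋ p = l i ℚ.≤ p × p ℚ.< r i

  _∋?_ : ∀ i p → Dec (i ∋ p)
  i ∋? p = (l i ℚ.≤? p) ×-dec (p ℚ.<? r i)

  Overlap : I → I → Set
  Overlap i j = l i ℚ.< r j × l j ℚ.< r i

  ∋-overlap : ∀ {i j p} → i ∋ p → j ∋ p → Overlap i j
  ∋-overlap (li≤p , p<ri) (lj≤p , p<rj) = ℚ.≤-<-trans li≤p p<rj , ℚ.≤-<-trans lj≤p p<ri

  ∋-straddled : ∀ {a b c p q y} → a ∋ p → b ∋ q → p ℚ.≤ y → y ℚ.≤ q →
                ¬ a ∋ y → ¬ b ∋ y → Overlap c a → Overlap c b → c ∋ y
  ∋-straddled (la≤p , _) (_ , q<rb) p≤y y≤q a∌y b∌y (lc<ra , _) (_ , lb<rc) =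
    ℚ.<⇒≤ (ℚ.<-≤-trans lc<ra ra≤y) , ℚ.<-trans y<lb lb<rc
    where
    ra≤y = ℚ.≮⇒≥ λ y<ra → a∌y (ℚ.≤-trans la≤p p≤y , y<ra)
    y<lb = ℚ.≰⇒> λ lb≤y → b∌y (lb≤y , ℚ.≤-<-trans y≤q q<rb)

  helly : (xs : List I) → (∀ {i j} → i ∈ xs → j ∈ xs → l i ℚ.< r j) → ∃ λ p → All (_∋ p) xs
  helly [] _ = 0ℚ , []
  helly xs@(x ∷ xs′) meet = l m , All.tabulate λ i∈xs → All.lookup l≤l[m] i∈xs , meet m∈xs i∈xs
    where
    m = argmax l x xs′
    m∈xs : m ∈ xs
    m∈xs = [ here , there ]′ (argmax-sel l x xs′)
    l≤l[m] : All (λ i → l i ℚ.≤ l m) xs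
    l≤l[m] = f[⊥]≤f[argmax] {f = l} x xs′ ∷ f[xs]≤f[argmax] x xs′

  record SortedStabbing (L : ℕ) : Set where
    field
      point   : Fin L → ℚ
      sorted  : ∀ {a b} → a Fin.≤ b → point a ℚ.≤ point b
      stabbed : ∀ i → ∃ λ j → i ∋ point j

  sort-stabbing : ∀ {m} (P : Fin m → ℚ) → (∀ i → ∃ λ c → i ∋ P c) → SortedStabbing m
  sort-stabbing {m} P P-stabs = subst SortedStabbing length≡m record
    { point   = lookup ys
    ; sorted  = lookup-mono-≤ (DecTotalOrder.totalOrder ≤-decTotalOrder) (sort-↗ xs)
    ; stabbed = stabbed
    }
    where
    xs = tabulate P
    ys = sort xs
    length≡m : length ys ≡ m
    length≡m = trans (↭-length (sort-↭ xs)) (length-tabulate P)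
    stabbed : ∀ i → ∃ λ j → i ∋ lookup ys j
    stabbed i = let c , i∋Pc = P-stabs i
                    Pc∈ys = ∈-resp-↭ (↭-sym (sort-↭ xs)) (∈-tabulate⁺ c)
                in index Pc∈ys , subst (i ∋_) (lookup-index Pc∈ys) i∋Pc

module IntervalGraph {n} (G : Graph n) (l r : Fin n → ℚ) (l<r : ∀ i → l i ℚ.< r i)
  (adj : ∀ i j → i ≢ j → Adj G i j ⇔ (l i ℚ.< r j × l j ℚ.< r i)) where

  open Intervals l r

  adjacent⇒overlap : ∀ {i j} → Adj G i j → Overlap i j
  adjacent⇒overlap {i} {j} i~j = Equivalence.to (adj i j i≢j) i~j
    where
    i≢j : i ≢ j
    i≢j refl = irrefl G i~j

  overlap⇒adjacent : ∀ {i j} → i ≢ j → Overlap i j → Adj G i j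
  overlap⇒adjacent {i} {j} i≢j = Equivalence.from (adj i j i≢j)

  cliques⇒stabbing : ∀ {m} → CliquePartition G m → SortedStabbing m
  cliques⇒stabbing {m} (f , clique) = sort-stabbing point (λ i → f i , stabs i)
    where
    in-class? : ∀ c i → Dec (f i ≡ c)
    in-class? c i = f i ≟ᶠ c
    members : Fin m → List (Fin n)
    members c = filter (in-class? c) (allFin n)
    same-clique⇒meet : ∀ {i j} → f i ≡ f j → l i ℚ.< r j
    same-clique⇒meet {i} {j} fi≡fj with i ≟ᶠ j
    ... | yes refl = l<r i
    ... | no i≢j = proj₁ (adjacent⇒overlap (clique i j fi≡fj i≢j))
    member⇒in-class : ∀ {c i} → i ∈ members c → f i ≡ c
    member⇒in-class {c} i∈c = proj₂ (∈-filter⁻ (in-class? c) {xs = allFin n} i∈c)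
    meet : ∀ c {i j} → i ∈ members c → j ∈ members c → l i ℚ.< r j
    meet c i∈c j∈c = same-clique⇒meet (trans (member⇒in-class i∈c) (sym (member⇒in-class j∈c)))
    point : Fin m → ℚ
    point c = proj₁ (helly (members c) (meet c))
    stabs : ∀ i → i ∋ point (f i)
    stabs i = All.lookup (proj₂ (helly (members (f i)) (meet (f i))))
                         (∈-filter⁺ (in-class? (f i)) (∈-allFin i) refl)

  module _ (v k : ℕ) {L} (S : SortedStabbing L) (L<K : L < suc v ^ suc k) where

    open SortedStabbing S

    -- 1-based, so that no point sits at position 0, which every power divides
    position : Fin L → ℕ
    position j = suc (toℕ j)

    _Reaches_ : Fin n → ℕ → Set
    i Reaches t = ∃ λ j → i ∋ point j × suc v ^ t ∣ position j

    _Reaches?_ : ∀ i → Decidable (i Reaches_)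
    i Reaches? t = any? λ j → (i ∋? point j) ×-dec (suc v ^ t ∣? position j)

    reaches-0 : ∀ i → i Reaches 0
    reaches-0 i = let j , i∋j = stabbed i in j , i∋j , 1∣ position j

    ¬reaches-suc-k : ∀ i → ¬ i Reaches suc k
    ¬reaches-suc-k i (j , _ , K∣j) = <⇒≱ L<K (≤-trans (∣⇒≤ K∣j) (toℕ<n j))

    level : Fin n → ℕ
    level i = greatest (i Reaches?_) k

    reaches-level : ∀ i → i Reaches level i
    reaches-level i = greatest-satisfies (i Reaches?_) (reaches-0 i) k

    ¬reaches-above-level : ∀ i → ¬ i Reaches suc (level i)
    ¬reaches-above-level i = greatest-maximal (i Reaches?_) k (¬reaches-suc-k i)

    colour : Fin n → Fin (suc k)
    colour i = fromℕ< (s≤s (greatest-≤ (i Reaches?_) k))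

    same-colour⇒same-level : ∀ {i i′} → colour i ≡ colour i′ → level i ≡ level i′
    same-colour⇒same-level eq = trans (sym (toℕ-fromℕ< _)) (trans (cong toℕ eq) (toℕ-fromℕ< _))

    position-between : ∀ {a b N} → position a ≤ N → N ≤ position b →
                       ∃ λ J → position J ≡ N × a Fin.≤ J × J Fin.≤ b
    position-between {a} {b} {suc N} (s≤s a≤N) (s≤s N≤b) =
      J , cong suc toℕJ≡N , subst (toℕ a ≤_) (sym toℕJ≡N) a≤N , subst (_≤ toℕ b) (sym toℕJ≡N) N≤b
      where
      N<L = ≤-<-trans N≤b (toℕ<n b)
      J = fromℕ< N<L
      toℕJ≡N = toℕ-fromℕ< N<L

    centre-reaches : ∀ {t c a b ja jb N} → Adj G c a → Adj G c b → a ∋ point ja → b ∋ point jb →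
                     ¬ a Reaches t → ¬ b Reaches t →
                     position ja ≤ N → N ≤ position jb → suc v ^ t ∣ N → c Reaches t
    centre-reaches {t} c~a c~b a∋ja b∋jb a-low b-low ja≤N N≤jb t∣N
      with J , J≡N , ja≤J , J≤jb ← position-between ja≤N N≤jb =
      J , ∋-straddled a∋ja b∋jb (sorted ja≤J) (sorted J≤jb) (λ a∋J → a-low (J , a∋J , t∣J))
            (λ b∋J → b-low (J , b∋J , t∣J)) (adjacent⇒overlap c~a) (adjacent⇒overlap c~b)
        , t∣J
      where
      t∣J = subst (suc v ^ t ∣_) (sym J≡N) t∣N

    no-star-within-level : ∀ {t} c (x : Fin (suc v) → Fin n) → Injective _≡_ _≡_ x →
      (∀ a → Adj G c (x a)) → (∀ a b → ¬ Adj G (x a) (x b)) →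
      ¬ c Reaches suc t → (∀ a → x a Reaches t) → (∀ a → ¬ x a Reaches suc t) → ⊥
    no-star-within-level {t} c x x-inj c~x x≁x c-low x-reaches x-low =
      let a , b , a<b , digits≡ = pigeonhole ≤-refl (λ a → punchOut (digit≢0 a)) in
      x≁x a b (same-digit⇒adjacent a<b digits≡)
      where
      T = suc v ^ t
      j : Fin (suc v) → Fin L
      j a = proj₁ (x-reaches a)
      x∋j : ∀ a → x a ∋ point (j a)
      x∋j a = proj₁ (proj₂ (x-reaches a))
      w : Fin (suc v) → ℕ
      w a = _∣_.quotient (proj₂ (proj₂ (x-reaches a)))
      position≡ : ∀ a → position (j a) ≡ w a * T
      position≡ a = _∣_.equality (proj₂ (proj₂ (x-reaches a)))

      block : Fin (suc v) → ℕ
      block a = w a / suc v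

      no-gap : ∀ a b → ¬ block a < block b
      no-gap a b lt =
        c-low (centre-reaches {t = suc t} (c~x a) (c~x b) (x∋j a) (x∋j b) (x-low a) (x-low b)
                 ja≤N N≤jb (divides (block b) (*-assoc (block b) (suc v) T)))
        where
        N = block b * suc v * T
        ja≤N : position (j a) ≤ N
        ja≤N = subst (_≤ N) (sym (position≡ a))
                 (*-monoˡ-≤ T (<⇒≤ (m/n<o/n⇒m<o/n*n (suc v) {w a} {w b} lt)))
        N≤jb : N ≤ position (j b)
        N≤jb = subst (N ≤_) (sym (position≡ b)) (*-monoˡ-≤ T (m/n*n≤m (w b) (suc v)))

      same-block : ∀ a b → block a ≡ block b
      same-block a b = ≤-antisym (≮⇒≥ (no-gap b a)) (≮⇒≥ (no-gap a b))

      digit : Fin (suc v) → Fin (suc v)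
      digit a = w a mod suc v

      toℕ-digit : ∀ a → toℕ (digit a) ≡ w a % suc v
      toℕ-digit a = toℕ-fromℕ< _

      digit≢0 : ∀ a → zero ≢ digit a
      digit≢0 a 0≡digit = x-low a (j a , x∋j a , subst (suc v ^ suc t ∣_) (sym (position≡ a)) v+1∣wa*T)
        where
        v+1∣wa*T = *-monoˡ-∣ T (m%n≡0⇒n∣m (w a) (suc v) (trans (sym (toℕ-digit a)) (cong toℕ (sym 0≡digit))))

      same-digit⇒adjacent : ∀ {a b} → a Fin.< b → punchOut (digit≢0 a) ≡ punchOut (digit≢0 b) →
                            Adj G (x a) (x b)
      same-digit⇒adjacent {a} {b} a<b digits≡ =
        overlap⇒adjacent (<⇒≢ a<b ∘ cong toℕ ∘ x-inj)
          (∋-overlap (x∋j a) (subst (λ j → x b ∋ point j) (sym ja≡jb) (x∋j b)))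
        where
        open ≡-Reasoning
        digit≡ = punchOut-injective (digit≢0 a) (digit≢0 b) digits≡
        wa≡wb = /-%-injective (suc v) {w a} {w b} (same-block a b)
                  (trans (sym (toℕ-digit a)) (trans (cong toℕ digit≡) (toℕ-digit b)))
        ja≡jb : j a ≡ j b
        ja≡jb = toℕ-injective (suc-injective (begin
          position (j a)  ≡⟨ position≡ a ⟩
          w a * T         ≡⟨ cong (_* T) wa≡wb ⟩
          w b * T         ≡⟨ sym (position≡ b) ⟩
          position (j b)  ∎))

    stabbing⇒κ≤ : κ≤ G v (suc k)
    stabbing⇒κ≤ = colour , colour-class-claw-free
      where
      colour-class-claw-free : ∀ p → ClawNumber≤ G (λ i → colour i ≡ p) v
      colour-class-claw-free p (c , x , c∈p , x∈p , x-inj , c~x , x≁x) =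
        no-star-within-level {level c} c x x-inj c~x x≁x (¬reaches-above-level c)
          (λ a → subst (x a Reaches_) (level≡ a) (reaches-level (x a)))
          (λ a → subst (λ t → ¬ x a Reaches suc t) (level≡ a) (¬reaches-above-level (x a)))
        where
        level≡ : ∀ a → level (x a) ≡ level c
        level≡ a = same-colour⇒same-level (trans (x∈p a) (sym c∈p))

lemma1 : (k v : ℕ) → k ≥ 1 → v ≥ 1 → (n : ℕ) → (G : Graph n) →
    IsIntervalGraph G → ϑ≤ G ((suc v) ^ k ∸ 1) → κ≤ G v k
lemma1 zero v () _ _ _ _ _
lemma1 (suc k) v _ _ n G (l , r , l<r , adj) ϑ =
  stabbing⇒κ≤ v k (cliques⇒stabbing ϑ) (≤-reflexive (suc-pred K {{m^n≢0 (suc v) (suc k)}}))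
  where
  open IntervalGraph G l r l<r adj
  K = suc v ^ suc k
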